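{- Let $G=(V,E)$ be a connected (claw, net)-free graph and $t\in V$. Then $t$ is the last vertex of some DFS ordering of $G$ if and only if $t$ is not a cut vertex of $G$.
   Context: A claw is the graph consisting of one vertex adjacent to three pairwise nonadjacent vertices of degree one. A net consists of a triangle whose three vertices are each adjacent to a distinct additional vertex of degree one. A graph is $H$-free if it contains no induced subgraph isomorphic to $H$. A cut vertex is a vertex whose removal disconnects the graph. A DFS (depth first search) ordering is an ordering obtained by starting at an arbitrary vertex and, at each step, visiting next an unvisited neighbour of the most recently visited vertex that still has an unvisited neighbour (backtracking as needed), with arbitrary tie-breaks. -}

module Defs where

open import Data.Nat using (ℕ; zero; suc; _<_; _≤_)
open import Data.Fin using (Fin; toℕ)
open import Data.Bool using (Bool; true; false; _∨_)
open import Data.Product using (Σ; _×_; ∃; ∃-syntax; _,_)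
open import Data.Unit using (⊤)
open import Relation.Nullary using (¬_)
open import Relation.Binary.PropositionalEquality using (_≡_; _≢_)
open import Function.Definitions using (Injective; Bijective)

record Graph (n : ℕ) : Set where
  field
    adj   : Fin n → Fin n → Bool
    sym   : ∀ u v → adj u v ≡ adj v u
    irrefl : ∀ u → adj u u ≡ false
open Graph public

data PathIn {n : ℕ} (G : Graph n) (allowed : Fin n → Set) : Fin n → Fin n → Set where
  here : ∀ {u} → allowed u → PathIn G allowed u u
  step : ∀ {u w v} → allowed u → adj G u w ≡ true → PathIn G allowed w v → PathIn G allowed u v

Connected : ∀ {n} → Graph n → Set
Connected G = ∀ u v → PathIn G (λ _ → ⊤) u v

CutVertex : ∀ {n} → Graph n → Fin n → Set
CutVertex G t = ∃[ u ] ∃[ v ] (u ≢ t × v ≢ t × ¬ PathIn G (λ x → x ≢ t) u v)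

ContainsInduced : ∀ {n k} → Graph n → (Fin k → Fin k → Bool) → Set
ContainsInduced {n} {k} G H =
  Σ (Fin k → Fin n) λ f → Injective _≡_ _≡_ f × (∀ i j → adj G (f i) (f j) ≡ H i j)

clawEdgeℕ : ℕ → ℕ → Bool
clawEdgeℕ 0 1 = true
clawEdgeℕ 0 2 = true
clawEdgeℕ 0 3 = true
clawEdgeℕ _ _ = false

clawAdj : Fin 4 → Fin 4 → Bool
clawAdj i j = clawEdgeℕ (toℕ i) (toℕ j) ∨ clawEdgeℕ (toℕ j) (toℕ i)

netEdgeℕ : ℕ → ℕ → Bool
netEdgeℕ 0 1 = true
netEdgeℕ 0 2 = true
netEdgeℕ 1 2 = true
netEdgeℕ 0 3 = true
netEdgeℕ 1 4 = true
netEdgeℕ 2 5 = true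
netEdgeℕ _ _ = false

netAdj : Fin 6 → Fin 6 → Bool
netAdj i j = netEdgeℕ (toℕ i) (toℕ j) ∨ netEdgeℕ (toℕ j) (toℕ i)

ClawFree : ∀ {n} → Graph n → Set
ClawFree G = ¬ ContainsInduced G clawAdj

NetFree : ∀ {n} → Graph n → Set
NetFree G = ¬ ContainsInduced G netAdj

-- DFS ordering: σ i is the (i+1)-th visited vertex.  σ is a bijection, and
-- for every position i, either no earlier vertex has an unvisited neighbour
-- (a new search is started at an arbitrary vertex), or σ i is a neighbour of
-- the most recently visited vertex σ j (j < i) that still has an unvisited
-- neighbour (every σ j' with j < j' < i has no unvisited neighbour).
HasUnvisitedNbr : ∀ {n} → Graph n → (Fin n → Fin n) → Fin n → Fin n → Set
HasUnvisitedNbr G σ i j = ∃[ k ] (toℕ i ≤ toℕ k × adj G (σ j) (σ k) ≡ true)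

IsDFSOrdering : ∀ {n} → Graph n → (Fin n → Fin n) → Set
IsDFSOrdering {n} G σ =
  Bijective _≡_ _≡_ σ ×
  (∀ (i : Fin n) →
     (∀ (j : Fin n) → toℕ j < toℕ i → ¬ HasUnvisitedNbr G σ i j)
     Data.Sum.⊎
     (∃[ j ] (toℕ j < toℕ i × adj G (σ j) (σ i) ≡ true ×
        (∀ (j' : Fin n) → toℕ j < toℕ j' → toℕ j' < toℕ i → ¬ HasUnvisitedNbr G σ i j'))))
  where import Data.Sum

IsLast : ∀ {n} → (Fin n → Fin n) → Fin n → Set
IsLast {n} σ t = ∃[ i ] (σ i ≡ t × ∀ (k : Fin n) → toℕ k ≤ toℕ i)

module Submission where

-- In a DFS ordering of a connected graph every vertex but the first has an earlier neighbour
-- (its parent), so following parents joins every vertex to the first one; if t is last it is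
-- never a parent, and these paths avoid t.
--
-- Conversely, suppose G − t is connected.  By claw-freeness, G − t has a path between two
-- neighbours of t through all neighbours of t: a missing neighbour y is attached at an end of the
-- path, or, when y sees neither end, the two ends are adjacent (else they form a claw with t and
-- y), so the path closes into a cycle that can be reopened next to a path from y.  A DFS starting
-- at one end follows this path towards t, but first explores every unvisited neighbour of the
-- current vertex from which t can no longer be reached; t is then visited last.

open import Defs hiding (sym)
open import Data.Bool.Base using (true; false)
import Data.Bool.Properties as Boolₚ
open import Data.Empty using (⊥-elim)
open import Data.Fin as F using (Fin; toℕ; _≟_)
import Data.Fin.Properties as Finₚ
open import Data.List using (List; []; _∷_; _++_; [_]; length; reverse; allFin)
import Data.List.Properties as Listₚ
open import Data.List.Membership.Propositional using (_∈_; _∉_)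
open import Data.List.Membership.Propositional.Properties
  using (∈-allFin; ∈-++⁺ˡ; ∈-++⁺ʳ; ∈-++⁻; ∈-∃++)
open import Data.List.Relation.Unary.All as All using (All; []; _∷_)
open import Data.List.Relation.Unary.Any as Any using (Any; here; there)
import Data.List.Relation.Unary.All.Properties as Allₚ
import Data.List.Relation.Unary.Any.Properties as Anyₚ
open import Data.List.Relation.Unary.AllPairs using ([]; _∷_)
open import Data.List.Relation.Unary.Unique.Propositional using (Unique)
open import Data.List.Relation.Binary.Subset.Propositional using (_⊆_)
import Data.List.Relation.Unary.Unique.Propositional.Properties as Uniqueₚ
open import Data.Vec using (Vec; []; _∷_; lookup)
import Data.Vec.Relation.Unary.AllPairs as VecAllPairs
import Data.Vec.Relation.Unary.All as VecAll
import Data.Vec.Relation.Unary.Unique.Propositional.Properties as VecUniqueₚ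
open import Data.Nat using (ℕ; zero; suc; _+_; _<_; _≤_; z≤n; s≤s)
import Data.Nat.Properties as ℕₚ
open import Data.Product using (_×_; _,_; proj₁; proj₂; ∃-syntax)
open import Data.Sum using (_⊎_; inj₁; inj₂; [_,_]′; map₂)
open import Data.Unit using (⊤)
open import Function using (_∘_)
open import Relation.Nullary using (¬_; ¬?; Dec; yes; no; _×-dec_)
open import Relation.Nullary.Decidable.Core using (toSum)
open import Relation.Binary.PropositionalEquality
  using (_≡_; _≢_; refl; trans; cong; subst; subst₂; module ≡-Reasoning) renaming (sym to ≡-sym)

module _ {n : ℕ} (G : Graph n) where

  private
    V : Set
    V = Fin n

  open import Data.List.Membership.DecPropositional (_≟_ {n}) using (_∈?_)

  infix 4 _~_ _~?_

  _~_ : V → V → Set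
  u ~ v = adj G u v ≡ true

  ~-sym : ∀ {u v} → u ~ v → v ~ u
  ~-sym {u} {v} u~v = trans (Graph.sym G v u) u~v

  ~-irrefl : ∀ {u} → ¬ u ~ u
  ~-irrefl {u} u~u with () ← trans (≡-sym (irrefl G u)) u~u

  ~⇒≢ : ∀ {u v} → u ~ v → u ≢ v
  ~⇒≢ u~v refl = ~-irrefl u~v

  _~?_ : ∀ u v → Dec (u ~ v)
  u ~? v = adj G u v Boolₚ.≟ true

  ≁⇒adj≡false : ∀ {u v} → ¬ u ~ v → adj G u v ≡ false
  ≁⇒adj≡false = Boolₚ.¬-not

  -- Walks and reachability

  Walk : (V → Set) → V → V → Set
  Walk = PathIn G

  head-allowed : ∀ {A u v} → Walk A u v → A u
  head-allowed (here a)     = a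
  head-allowed (step a _ _) = a

  last-allowed : ∀ {A u v} → Walk A u v → A v
  last-allowed (here a)     = a
  last-allowed (step _ _ p) = last-allowed p

  mapWalk : ∀ {A B : V → Set} {u v} → (∀ {x} → A x → B x) → Walk A u v → Walk B u v
  mapWalk f (here a)     = here (f a)
  mapWalk f (step a e p) = step (f a) e (mapWalk f p)

  infixr 5 _++ʷ_
  _++ʷ_ : ∀ {A u v w} → Walk A u v → Walk A v w → Walk A u w
  here _     ++ʷ q = q
  step a e p ++ʷ q = step a e (p ++ʷ q)

  reverseWalk : ∀ {A u v} → Walk A u v → Walk A v u
  reverseWalk (here a)     = here a
  reverseWalk (step a e p) = reverseWalk p ++ʷ step (head-allowed p) (~-sym e) (here a)

  Reach : List V → V → V → Set
  Reach R = Walk (_∉ R)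

  Reach-anti : ∀ {R S x y} → R ⊆ S → Reach S x y → Reach R x y
  Reach-anti R⊆S = mapWalk (_∘ R⊆S)

  ∉-++ : ∀ {S R : List V} {x} → x ∉ S → x ∉ R → x ∉ S ++ R
  ∉-++ {S} x∉S x∉R x∈ with ∈-++⁻ S x∈
  ... | inj₁ x∈S = x∉S x∈S
  ... | inj₂ x∈R = x∉R x∈R

  ∉-∷ : ∀ {R : List V} {v x} → x ≢ v → x ∉ R → x ∉ v ∷ R
  ∉-∷ x≢v = ∉-++ {[ _ ]} λ { (here x≡v) → x≢v x≡v }

  ∉-∷⁻ : ∀ {R : List V} {v x} → x ∉ v ∷ R → x ≢ v × x ∉ R
  ∉-∷⁻ x∉ = x∉ ∘ here , x∉ ∘ there

  Reach-weaken : ∀ {R v x y} → Reach (v ∷ R) x y → Reach R x y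
  Reach-weaken = Reach-anti there

  firstEntry : ∀ {R} (S : List V) {u x} → u ∉ S → Reach R u x →
               Reach (S ++ R) u x ⊎ (∃[ q ] ∃[ p ] (Reach (S ++ R) u q × q ~ p × p ∈ S))
  firstEntry S u∉S (here u∉R) = inj₁ (here (∉-++ u∉S u∉R))
  firstEntry S {u} u∉S (step {w = w} u∉R e p) with w ∈? S
  ... | yes w∈S = inj₂ (u , w , here (∉-++ u∉S u∉R) , e , w∈S)
  ... | no w∉S with firstEntry S w∉S p
  ...   | inj₁ p′                    = inj₁ (step (∉-++ u∉S u∉R) e p′)
  ...   | inj₂ (q , r , p′ , f , r∈S) = inj₂ (q , r , step (∉-++ u∉S u∉R) e p′ , f , r∈S)

  lastExit : ∀ {R x v} (u : V) → v ≢ u → Reach R x v →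
             Reach (u ∷ R) x v ⊎ (∃[ w ] (u ~ w × Reach (u ∷ R) w v))
  lastExit u v≢u (here v∉R) = inj₁ (here (∉-∷ v≢u v∉R))
  lastExit {x = x} u v≢u (step {w = w} x∉R e p) with lastExit u v≢u p
  ... | inj₂ exit = inj₂ exit
  ... | inj₁ p′ with x ≟ u
  ...   | yes refl = inj₂ (w , e , p′)
  ...   | no x≢u  = inj₁ (step (∉-∷ x≢u x∉R) e p′)

  private
    tally : ∀ {P : Set} → Dec P → ℕ → ℕ
    tally (yes _) k = k
    tally (no _)  k = suc k

    tally-mono : ∀ {P Q : Set} (P? : Dec P) (Q? : Dec Q) {a b} → (Q → P) → a ≤ b → tally P? a ≤ tally Q? b
    tally-mono (yes _) (yes _) _   a≤b = a≤b
    tally-mono (yes _) (no _)  _   a≤b = ℕₚ.m≤n⇒m≤1+n a≤b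
    tally-mono (no ¬p) (yes q) Q⇒P _   = ⊥-elim (¬p (Q⇒P q))
    tally-mono (no _)  (no _)  _   a≤b = s≤s a≤b

    tally-strict : ∀ {P Q : Set} (P? : Dec P) (Q? : Dec Q) {a b} → P → ¬ Q → a ≤ b → tally P? a < tally Q? b
    tally-strict (yes _) (no _)  _ _  a≤b = s≤s a≤b
    tally-strict (yes _) (yes q) _ ¬q _   = ⊥-elim (¬q q)
    tally-strict (no ¬p) _       p _  _   = ⊥-elim (¬p p)

    tally-mono-< : ∀ {P Q : Set} (P? : Dec P) (Q? : Dec Q) {a b} → (Q → P) → a < b → tally P? a < tally Q? b
    tally-mono-< (yes _) (yes _) _   a<b = a<b
    tally-mono-< (yes _) (no _)  _   a<b = ℕₚ.m<n⇒m<1+n a<b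
    tally-mono-< (no ¬p) (yes q) Q⇒P _   = ⊥-elim (¬p (Q⇒P q))
    tally-mono-< (no _)  (no _)  _   a<b = s≤s a<b

  outside : List V → List V → ℕ
  outside []       R = 0
  outside (x ∷ xs) R = tally (x ∈? R) (outside xs R)

  outside-mono : ∀ xs u R → outside xs (u ∷ R) ≤ outside xs R
  outside-mono []       u R = z≤n
  outside-mono (x ∷ xs) u R = tally-mono (x ∈? u ∷ R) (x ∈? R) there (outside-mono xs u R)

  outside-shrinks : ∀ xs {u R} → u ∉ R → u ∈ xs → outside xs (u ∷ R) < outside xs R
  outside-shrinks (x ∷ xs) {u} {R} u∉R (here refl) =
    tally-strict (x ∈? u ∷ R) (x ∈? R) (here refl) u∉R (outside-mono xs u R)
  outside-shrinks (x ∷ xs) {u} {R} u∉R (there u∈xs) =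
    tally-mono-< (x ∈? u ∷ R) (x ∈? R) there (outside-shrinks xs u∉R u∈xs)

  allVertices : List V
  allVertices = allFin n

  reach? : ∀ R u v → Dec (Reach R u v)
  reach? R = search (suc (outside allVertices R)) R ℕₚ.≤-refl
    where
      search : ∀ fuel R → outside allVertices R < fuel → ∀ u v → Dec (Reach R u v)
      search (suc fuel) R (s≤s bound) u v with u ∈? R | u ≟ v
      ... | yes u∈R | _        = no λ p → head-allowed p u∈R
      ... | no u∉R  | yes refl = yes (here u∉R)
      ... | no u∉R  | no u≢v
        with Finₚ.any? (λ w → u ~? w ×-dec search fuel (u ∷ R) bound′ w v)
        where bound′ = ℕₚ.<-≤-trans (outside-shrinks allVertices u∉R (∈-allFin u)) bound
      ...   | yes (w , e , p) = yes (step u∉R e (Reach-weaken p))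
      ...   | no ¬exit        =
        no λ p → [ (λ p′ → head-allowed p′ (here refl)) , ¬exit ]′ (lastExit u (u≢v ∘ ≡-sym) p)

  Unique-++⁻ˡ : ∀ (A : List V) {B} → Unique (A ++ B) → Unique A
  Unique-++⁻ˡ []      _          = []
  Unique-++⁻ˡ (x ∷ A) (x∉ ∷ uAB) = Allₚ.++⁻ˡ A x∉ ∷ Unique-++⁻ˡ A uAB

  Unique-++⁻ʳ : ∀ (A : List V) {B} → Unique (A ++ B) → Unique B
  Unique-++⁻ʳ []      uB        = uB
  Unique-++⁻ʳ (x ∷ A) (_ ∷ uAB) = Unique-++⁻ʳ A uAB

  Unique-++⇒disjoint : ∀ (A : List V) {B x} → Unique (A ++ B) → x ∈ A → x ∉ B
  Unique-++⇒disjoint (x ∷ A) (x∉ ∷ _)   (here refl) x∈B = All.lookup (Allₚ.++⁻ʳ A x∉) x∈B refl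
  Unique-++⇒disjoint (x ∷ A) (_ ∷ uAB)  (there x∈A) = Unique-++⇒disjoint A uAB x∈A

  Unique-∷ : ∀ {x : V} {A} → x ∉ A → Unique A → Unique (x ∷ A)
  Unique-∷ x∉A uA = All.tabulate (λ y∈A x≡y → x∉A (subst (_∈ _) (≡-sym x≡y) y∈A)) ∷ uA

  Unique-++-comm : ∀ (A : List V) {B} → Unique (A ++ B) → Unique (B ++ A)
  Unique-++-comm A uAB = Uniqueₚ.++⁺ (Unique-++⁻ʳ A uAB) (Unique-++⁻ˡ A uAB)
    λ (x∈B , x∈A) → Unique-++⇒disjoint A uAB x∈A x∈B

  ∈-++-comm : ∀ (A : List V) {B x} → x ∈ A ++ B → x ∈ B ++ A
  ∈-++-comm A {B} x∈ with ∈-++⁻ A x∈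
  ... | inj₁ x∈A = ∈-++⁺ʳ B x∈A
  ... | inj₂ x∈B = ∈-++⁺ˡ x∈B

  data Path : V → V → List V → Set where
    single : ∀ x → Path x x [ x ]
    extend : ∀ {x y z L} → x ~ y → Path y z L → Path x z (x ∷ L)

  Path-head∈ : ∀ {x z L} → Path x z L → x ∈ L
  Path-head∈ (single _)   = here refl
  Path-head∈ (extend _ _) = here refl

  Path-last∈ : ∀ {x z L} → Path x z L → z ∈ L
  Path-last∈ (single _)   = here refl
  Path-last∈ (extend _ p) = there (Path-last∈ p)

  glue : ∀ {x y z w L M} → Path x y L → y ~ z → Path z w M → Path x w (L ++ M)
  glue (single _)   e q = extend e q
  glue (extend f p) e q = extend f (glue p e q)

  Path-suffix : ∀ (L₁ : List V) {x z p L₂} → Path x z (L₁ ++ p ∷ L₂) → Path p z (p ∷ L₂)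
  Path-suffix []            (single _)   = single _
  Path-suffix []            (extend e p) = extend e p
  Path-suffix (_ ∷ [])      (extend _ p) = Path-suffix [] p
  Path-suffix (_ ∷ y ∷ L₁)  (extend _ p) = Path-suffix (y ∷ L₁) p

  Path-prefix : ∀ (y : V) (L₁ : List V) {x z p L₂} → Path x z ((y ∷ L₁) ++ p ∷ L₂) →
                ∃[ q ] (Path x q (y ∷ L₁) × q ~ p)
  Path-prefix y []        (extend e (single _))   = y , single y , e
  Path-prefix y []        (extend e (extend _ _)) = y , single y , e
  Path-prefix y (y′ ∷ L₁) (extend e p) with Path-prefix y′ L₁ p
  ... | q , p′ , f = q , extend e p′ , f

  Path-reach : ∀ {R x z L} → Path x z L → All (_∉ R) L → ∀ {y} → y ∈ L → Reach R y z
  Path-reach (single _)   (x∉ ∷ [])  (here refl) = here x∉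
  Path-reach (extend e p) (x∉ ∷ L∉)  (here refl) = step x∉ e (Path-reach p L∉ (Path-head∈ p))
  Path-reach (extend e p) (_  ∷ L∉)  (there y∈)  = Path-reach p L∉ y∈

  Path-reach-tail : ∀ {R a z L} → Path a z (a ∷ L) → All (_∉ R) L → ∀ {y} → y ∈ L → Reach R y z
  Path-reach-tail (extend _ p) L∉ y∈ = Path-reach p L∉ y∈

  Path-first-edge : ∀ {a y z L} → Path a z (a ∷ y ∷ L) → a ~ y
  Path-first-edge (extend e (single _))   = e
  Path-first-edge (extend e (extend _ _)) = e

  Path-tail : ∀ {a y z L} → Path a z (a ∷ y ∷ L) → Path y z (y ∷ L)
  Path-tail (extend _ p) = Path-suffix [] p

  Path-view : ∀ {x z L} → Path x z L → ∃[ Y ] (L ≡ x ∷ Y)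
  Path-view (single _)   = [] , refl
  Path-view (extend _ p) = _ , refl

  closedPath-trivial : ∀ {h L} → Path h h L → Unique L → ∀ {x} → x ∈ L → x ≡ h
  closedPath-trivial (single _)   _        (here refl) = refl
  closedPath-trivial (extend _ p) (h∉ ∷ _) _           = ⊥-elim (All.lookup h∉ (Path-last∈ p) refl)

  simplify : ∀ {A u v} → Walk A u v → ∃[ L ] (Path u v L × Unique L × All A L)
  simplify (here a) = _ , single _ , [] ∷ [] , a ∷ []
  simplify {u = u} (step a e w) with simplify w
  ... | L , p , uL , aL with u ∈? L
  ...   | no u∉L  = u ∷ L , extend e p , Unique-∷ u∉L uL , a ∷ aL
  ...   | yes u∈L with ∈-∃++ u∈L
  ...     | L₁ , L₂ , refl = u ∷ L₂ , Path-suffix L₁ p , Unique-++⁻ʳ L₁ uL , Allₚ.++⁻ʳ L₁ aL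

  cutAfterLast : ∀ {P : V → Set} (P? : ∀ x → Dec (P x)) {x z L} → Path x z L → Any P L →
                 ∃[ z′ ] ∃[ L′ ] ∃[ rest ] (Path x z′ L′ × P z′ × L ≡ L′ ++ rest × All (¬_ ∘ P) rest)
  cutAfterLast P? (single x) (here px) = x , [ x ] , [] , single x , px , refl , []
  cutAfterLast P? {x} (extend {L = L} e p) anyP with Any.any? P? L | anyP
  ... | yes anyL | _ with cutAfterLast P? p anyL
  ...   | z′ , L′ , rest , p′ , pz′ , refl , ¬rest = z′ , x ∷ L′ , rest , extend e p′ , pz′ , refl , ¬rest
  cutAfterLast P? {x} (extend {L = L} e p) anyP | no ¬anyL | here px =
    x , [ x ] , L , single x , px , refl , Allₚ.¬Any⇒All¬ L ¬anyL
  cutAfterLast P? (extend e p) anyP | no ¬anyL | there anyL = ⊥-elim (¬anyL anyL)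

  -- A path through the neighbourhood of t

  induced-claw : ∀ {t a b c} → t ~ a → t ~ b → t ~ c → a ≢ b → a ≢ c → b ≢ c →
                 ¬ a ~ b → ¬ a ~ c → ¬ b ~ c → ContainsInduced G clawAdj
  induced-claw {t} {a} {b} {c} ta tb tc a≢b a≢c b≢c ¬ab ¬ac ¬bc =
    lookup vs , VecUniqueₚ.lookup-injective distinct _ _ , induced
    where
      open F using (zero; suc)
      vs : Vec V 4
      vs = t ∷ a ∷ b ∷ c ∷ []
      distinct : VecAllPairs.AllPairs _≢_ vs
      distinct = (~⇒≢ ta VecAll.∷ ~⇒≢ tb VecAll.∷ ~⇒≢ tc VecAll.∷ VecAll.[])
           VecAllPairs.∷ (a≢b VecAll.∷ a≢c VecAll.∷ VecAll.[])
           VecAllPairs.∷ (b≢c VecAll.∷ VecAll.[])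
           VecAllPairs.∷ VecAll.[]
           VecAllPairs.∷ VecAllPairs.[]
      induced : ∀ i j → adj G (lookup vs i) (lookup vs j) ≡ clawAdj i j
      induced zero                   zero                   = irrefl G t
      induced zero                   (suc zero)             = ta
      induced zero                   (suc (suc zero))       = tb
      induced zero                   (suc (suc (suc zero))) = tc
      induced (suc zero)             zero                   = ~-sym ta
      induced (suc zero)             (suc zero)             = irrefl G a
      induced (suc zero)             (suc (suc zero))       = ≁⇒adj≡false ¬ab
      induced (suc zero)             (suc (suc (suc zero))) = ≁⇒adj≡false ¬ac
      induced (suc (suc zero))       zero                   = ~-sym tb
      induced (suc (suc zero))       (suc zero)             = ≁⇒adj≡false (¬ab ∘ ~-sym)
      induced (suc (suc zero))       (suc (suc zero))       = irrefl G b
      induced (suc (suc zero))       (suc (suc (suc zero))) = ≁⇒adj≡false ¬bc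
      induced (suc (suc (suc zero))) zero                   = ~-sym tc
      induced (suc (suc (suc zero))) (suc zero)             = ≁⇒adj≡false (¬ac ∘ ~-sym)
      induced (suc (suc (suc zero))) (suc (suc zero))       = ≁⇒adj≡false (¬bc ∘ ~-sym)
      induced (suc (suc (suc zero))) (suc (suc (suc zero))) = irrefl G c

  rotate : ∀ (L₁ : List V) {h l p L₂} → Path h l (L₁ ++ p ∷ L₂) → l ~ h → ∃[ z ] Path p z ((p ∷ L₂) ++ L₁)
  rotate []       {L₂ = L₂} path _ =
    _ , subst (Path _ _) (≡-sym (Listₚ.++-identityʳ (_ ∷ L₂))) (Path-suffix [] path)
  rotate (y ∷ L₁) path l~h with Path-prefix y L₁ path
  ... | q , prefix , _ = q , glue (Path-suffix (y ∷ L₁) path) l~h prefix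

  module _ (t : V) where

    record AnchoredPath : Set where
      constructor anchored
      field
        from to  : V
        vertices : List V
        path     : Path from to vertices
        unique   : Unique vertices
        avoids   : t ∉ vertices
        t~from   : t ~ from
    open AnchoredPath

    trimToNeighbour : (P : AnchoredPath) →
                      ∃[ P′ ] (t ~ to P′ × ∀ {x} → x ∈ vertices P → t ~ x → x ∈ vertices P′)
    trimToNeighbour (anchored h _ L p uL tL th)
      with cutAfterLast (t ~?_) p (Any.map (λ { refl → th }) (Path-head∈ p))
    ... | z , L′ , rest , p′ , tz , refl , rest≁t =
      anchored h z L′ p′ (Unique-++⁻ˡ L′ uL) (tL ∘ ∈-++⁺ˡ) th , tz , covered
      where
        covered : ∀ {x} → x ∈ L′ ++ rest → t ~ x → x ∈ L′
        covered {x} x∈ tx with ∈-++⁻ L′ x∈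
        ... | inj₁ x∈L′   = x∈L′
        ... | inj₂ x∈rest = ⊥-elim (All.lookup rest≁t x∈rest tx)

    Extension : AnchoredPath → V → Set
    Extension P y = ∃[ P′ ] (y ∈ vertices P′ × vertices P ⊆ vertices P′)

    module _ (clawFree : ClawFree G) (connected : ∀ u v → u ≢ t → v ≢ t → Reach [ t ] u v) where

      nbr≢t : ∀ {x} → t ~ x → x ≢ t
      nbr≢t tx = ~⇒≢ tx ∘ ≡-sym

      reroute : ∀ (P : AnchoredPath) {y} → to P ~ from P → t ~ y → y ∉ vertices P → Extension P y
      reroute (anchored h l L p uL tL th) {y} l~h ty y∉L
        with firstEntry L y∉L (connected y h (nbr≢t ty) (nbr≢t th))
      ... | inj₁ w = ⊥-elim (last-allowed w (∈-++⁺ˡ (Path-head∈ p)))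
      ... | inj₂ (q , r , w , q~r , r∈L) with simplify w | ∈-∃++ r∈L
      ...   | Q , pQ , uQ , Q∉ | L₁ , L₂ , refl with rotate L₁ p l~h
      ...     | z , pR = anchored y z (Q ++ (r ∷ L₂) ++ L₁) (glue pQ q~r pR) Q++R-unique t∉ ty ,
                         ∈-++⁺ˡ (Path-head∈ pQ) , ∈-++⁺ʳ Q ∘ ∈-++-comm L₁
        where
          Q++R-unique : Unique (Q ++ (r ∷ L₂) ++ L₁)
          Q++R-unique = Uniqueₚ.++⁺ uQ (Unique-++-comm L₁ uL)
                     λ (x∈Q , x∈R) → All.lookup Q∉ x∈Q (∈-++⁺ˡ (∈-++-comm (r ∷ L₂) x∈R))
          t∉ : t ∉ Q ++ (r ∷ L₂) ++ L₁
          t∉ t∈ with ∈-++⁻ Q t∈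
          ... | inj₁ t∈Q = All.lookup Q∉ t∈Q (∈-++⁺ʳ (L₁ ++ r ∷ L₂) (here refl))
          ... | inj₂ t∈R = tL (∈-++-comm (r ∷ L₂) t∈R)

      extend-by : ∀ (P : AnchoredPath) → t ~ to P → ∀ {y} → t ~ y → y ∉ vertices P → Extension P y
      extend-by (anchored h l L p uL tL th) tl {y} ty y∉L with l ~? y | y ~? h | h ≟ l
      ... | yes l~y | _       | _ =
        anchored h y (L ++ [ y ]) (glue p l~y (single y))
          (Uniqueₚ.++⁺ uL ([] ∷ []) λ { (y∈L , here refl) → y∉L y∈L })
          (∉-++ tL λ { (here refl) → ~-irrefl ty }) th ,
        ∈-++⁺ʳ L (here refl) , ∈-++⁺ˡ
      ... | no _    | yes y~h | _ =
        anchored y l (y ∷ L) (extend y~h p) (Unique-∷ y∉L uL)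
          (λ { (here refl) → ~-irrefl ty ; (there t∈L) → tL t∈L }) ty ,
        here refl , there
      ... | no _    | no _    | yes refl with simplify (connected y h (nbr≢t ty) (nbr≢t th))
      ...   | Q , pQ , uQ , Q∉ =
        anchored y h Q pQ uQ (λ t∈Q → All.lookup Q∉ t∈Q (here refl)) ty ,
        Path-head∈ pQ , λ x∈L → subst (_∈ Q) (≡-sym (closedPath-trivial p uL x∈L)) (Path-last∈ pQ)
      extend-by P@(anchored h l L p uL tL th) tl {y} ty y∉L | no ¬l~y | no ¬y~h | no h≢l
        with h ~? l
      ... | yes h~l = reroute P (~-sym h~l) ty y∉L
      ... | no ¬h~l = ⊥-elim (clawFree (induced-claw th tl ty h≢l
                        (λ { refl → y∉L (Path-head∈ p) }) (λ { refl → y∉L (Path-last∈ p) })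
                        ¬h~l (¬y~h ∘ ~-sym) ¬l~y))

      neighbourhoodPath : ∀ (vs : List V) →
        (∀ {x} → x ∈ vs → ¬ t ~ x) ⊎ (∃[ P ] (t ~ to P × ∀ {x} → x ∈ vs → t ~ x → x ∈ vertices P))
      neighbourhoodPath [] = inj₁ λ ()
      neighbourhoodPath (x ∷ vs) with neighbourhoodPath vs | t ~? x
      ... | inj₁ none | no ¬tx = inj₁ λ { (here refl) → ¬tx ; (there x∈) → none x∈ }
      ... | inj₁ none | yes tx =
        inj₂ (anchored x x [ x ] (single x) ([] ∷ []) (λ { (here refl) → ~-irrefl tx }) tx , tx ,
              λ { (here refl) _ → here refl ; (there x∈) tx′ → ⊥-elim (none x∈ tx′) })
      ... | inj₂ (P , tl , cover) | no ¬tx =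
        inj₂ (P , tl , λ { (here refl) tx → ⊥-elim (¬tx tx) ; (there x∈) → cover x∈ })
      ... | inj₂ (P , tl , cover) | yes tx with x ∈? vertices P
      ...   | yes x∈P = inj₂ (P , tl , λ { (here refl) _ → x∈P ; (there x∈) → cover x∈ })
      ...   | no x∉P with extend-by P tl tx x∉P
      ...     | P′ , x∈P′ , P⊆P′ with trimToNeighbour P′
      ...       | P″ , tl″ , cover″ =
        inj₂ (P″ , tl″ , λ { (here refl) tx  → cover″ x∈P′ tx
                           ; (there x∈) tx′ → cover″ (P⊆P′ (cover x∈ tx′)) tx′ })

  -- Depth-first search ending at t

  Exhausted : List V → V → Set
  Exhausted R x = ∀ w → x ~ w → w ∈ R

  HasUnvisited : List V → V → Set
  HasUnvisited R x = ∃[ w ] (x ~ w × w ∉ R)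

  -- Visit lists are kept most recent first: v may follow the visits R when it is adjacent to
  -- some visited p such that every vertex visited after p is exhausted.
  LegalNext : List V → V → Set
  LegalNext R v = ∃[ A ] ∃[ p ] ∃[ B ] (R ≡ A ++ p ∷ B × p ~ v × All (Exhausted R) A)

  data DFSPrefix : List V → Set where
    start : ∀ v → DFSPrefix [ v ]
    visit : ∀ {R v} → DFSPrefix R → v ∉ R → LegalNext R v → DFSPrefix (v ∷ R)

  hasUnvisited? : ∀ R x → Dec (HasUnvisited R x)
  hasUnvisited? R x = Finₚ.any? λ w → x ~? w ×-dec ¬? (w ∈? R)

  ¬HasUnvisited⇒Exhausted : ∀ {R x} → ¬ HasUnvisited R x → Exhausted R x
  ¬HasUnvisited⇒Exhausted {R} ¬h w x~w with w ∈? R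
  ... | yes w∈R = w∈R
  ... | no w∉R  = ⊥-elim (¬h (w , x~w , w∉R))

  firstActive : ∀ R L → All (Exhausted R) L ⊎
                (∃[ A ] ∃[ p ] ∃[ B ] (L ≡ A ++ p ∷ B × All (Exhausted R) A × HasUnvisited R p))
  firstActive R [] = inj₁ []
  firstActive R (x ∷ L) with hasUnvisited? R x
  ... | yes h = inj₂ ([] , x , L , refl , [] , h)
  ... | no ¬h with firstActive R L
  ...   | inj₁ all = inj₁ (¬HasUnvisited⇒Exhausted ¬h ∷ all)
  ...   | inj₂ (A , p , B , refl , exA , h) = inj₂ (x ∷ A , p , B , refl , ¬HasUnvisited⇒Exhausted ¬h ∷ exA , h)

  compareSplits : ∀ (A A′ : List V) {a p B B′} → A ++ a ∷ B ≡ A′ ++ p ∷ B′ →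
                  p ∈ A ⊎ (A ≡ A′ × a ≡ p) ⊎ a ∈ A′
  compareSplits []      []       refl = inj₂ (inj₁ (refl , refl))
  compareSplits []      (_ ∷ _)  refl = inj₂ (inj₂ (here refl))
  compareSplits (_ ∷ _) []       refl = inj₁ (here refl)
  compareSplits (x ∷ A) (y ∷ A′) eq with Listₚ.∷-injective eq
  ... | refl , eq′ with compareSplits A A′ eq′
  ...   | inj₁ p∈A                = inj₁ (there p∈A)
  ...   | inj₂ (inj₁ (refl , a≡p)) = inj₂ (inj₁ (refl , a≡p))
  ...   | inj₂ (inj₂ a∈A′)        = inj₂ (inj₂ (there a∈A′))

  avoidOrApproach : ∀ {R u x} v → u ≢ v → Reach R u x → Reach (v ∷ R) u x ⊎ (∃[ q ] (Reach (v ∷ R) u q × q ~ v))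
  avoidOrApproach v u≢v p with firstEntry [ v ] (λ { (here u≡v) → u≢v u≡v }) p
  ... | inj₁ p′                         = inj₁ p′
  ... | inj₂ (q , _ , p′ , q~v , here refl) = inj₂ (q , p′ , q~v)

  module _ (t : V) where

    Attached : List V → List V → V → Set
    Attached R Z u = ∃[ w ] ∃[ z ] (Reach R u w × z ~ w × z ∈ Z)

    reattach : ∀ {R Z u v} → u ≢ v → ¬ Reach (v ∷ R) u t →
               Reach R u t ⊎ Attached R Z u → Attached (v ∷ R) (v ∷ Z) u
    reattach {v = v} u≢v ¬reach (inj₁ p) with avoidOrApproach v u≢v p
    ... | inj₁ p′            = ⊥-elim (¬reach p′)
    ... | inj₂ (q , p′ , q~v) = q , v , p′ , ~-sym q~v , here refl
    reattach {v = v} u≢v ¬reach (inj₂ (w , z , p , z~w , z∈Z)) with avoidOrApproach v u≢v p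
    ... | inj₁ p′            = w , z , p′ , z~w , there z∈Z
    ... | inj₂ (q , p′ , q~v) = q , v , p′ , ~-sym q~v , here refl

    -- The search follows a path anchor, route, t through all unvisited neighbours of t.  Between
    -- two route vertices it visits "offs", vertices from which t can no longer be reached; every
    -- unvisited vertex cut off from t stays attached to the anchor or to an off vertex.
    record State (R : List V) : Set where
      field
        prefix          : DFSPrefix R
        t∉R             : t ∉ R
        offs            : List V
        anchor          : V
        older           : List V
        split           : R ≡ offs ++ anchor ∷ older
        route           : List V
        route-path      : Path anchor t (anchor ∷ route ++ [ t ])
        route-unvisited : All (_∉ R) route
        route-unique    : Unique (route ++ [ t ])
        route-covers    : ∀ {x} → t ~ x → x ∉ R → x ∈ route
        offs-cut        : All (λ x → ∀ {w} → x ~ w → w ∉ R → ¬ Reach R w t) offs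
        stranded        : ∀ {u} → u ∉ R → ¬ Reach R u t → Attached R (offs ++ [ anchor ]) u

      route-reach : ∀ {x} → x ∈ route → Reach R x t
      route-reach x∈ = Path-reach-tail route-path (Allₚ.++⁺ route-unvisited (t∉R ∷ [])) (∈-++⁺ˡ x∈)

      anchor-active : HasUnvisited R anchor
      anchor-active with route | route-path | route-unvisited
      ... | []    | p | _       = t , Path-first-edge p , t∉R
      ... | y ∷ _ | p | y∉R ∷ _ = y , Path-first-edge p , y∉R

      unstranded : All (Exhausted R) offs → (∀ {w} → anchor ~ w → w ∉ R → Reach R w t) →
                   ∀ {u} → u ∉ R → Reach R u t
      unstranded offs-exhausted anchor-reach {u} u∉R with reach? R u t
      ... | yes p  = p
      ... | no ¬p with stranded u∉R ¬p
      ...   | w , z , p , z~w , z∈ with ∈-++⁻ offs z∈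
      ...     | inj₁ z∈offs      = ⊥-elim (last-allowed p (All.lookup offs-exhausted z∈offs w z~w))
      ...     | inj₂ (here refl) = ⊥-elim (¬p (p ++ʷ anchor-reach z~w (last-allowed p)))

    Step : List V → Set
    Step R = ∃[ v ] (v ∉ R × State (v ∷ R))

    Complete : List V → Set
    Complete R = DFSPrefix (t ∷ R) × (∀ u → u ∈ t ∷ R)

    visitStranded : ∀ {R v} → State R → v ∉ R → ¬ Reach R v t → LegalNext R v → State (v ∷ R)
    visitStranded {R} {v} I v∉R ¬vt legal = record
      { prefix          = visit prefix v∉R legal
      ; t∉R             = ∉-∷ (λ { refl → ¬vt (here v∉R) }) t∉R
      ; offs            = v ∷ offs
      ; anchor          = anchor
      ; older           = older
      ; split           = cong (v ∷_) split
      ; route           = route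
      ; route-path      = route-path
      ; route-unvisited = All.tabulate λ x∈ → ∉-∷ (λ { refl → ¬vt (route-reach x∈) }) (All.lookup route-unvisited x∈)
      ; route-unique    = route-unique
      ; route-covers    = λ tx x∉ → route-covers tx (proj₂ (∉-∷⁻ x∉))
      ; offs-cut        = (λ {w} v~w _ wt → ¬vt (step v∉R v~w (Reach-weaken wt)))
                          ∷ All.map (λ cut {w} x~w w∉ → cut x~w (proj₂ (∉-∷⁻ w∉)) ∘ Reach-weaken) offs-cut
      ; stranded        = λ {u} u∉ ¬ut → let u≢v , u∉R = ∉-∷⁻ u∉ in
                          reattach u≢v ¬ut (map₂ (stranded u∉R) (toSum (reach? R u t)))
      }
      where open State I

    module _ {R} (I : State R) (offs-exhausted : All (Exhausted R) (State.offs I))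
             (anchor-reach : ∀ {w} → State.anchor I ~ w → w ∉ R → Reach R w t) where
      open State I

      finish : route ≡ [] → Complete R
      finish route≡[] with route | route-path | route-covers | route≡[]
      ... | [] | p | covers | refl = visit prefix t∉R legal , covered
        where
          legal = offs , anchor , older , split , Path-first-edge p , offs-exhausted
          covered : ∀ u → u ∈ t ∷ R
          covered u with u ∈? R | u ≟ t
          ... | yes u∈R | _        = there u∈R
          ... | no _    | yes refl = here refl
          ... | no u∉R  | no u≢t with avoidOrApproach t u≢t (unstranded offs-exhausted anchor-reach u∉R)
          ...   | inj₁ p′            = ⊥-elim (last-allowed p′ (here refl))
          ...   | inj₂ (q , p′ , q~t) with () ← covers (~-sym q~t) (proj₂ (∉-∷⁻ (last-allowed p′)))

      visitRoute : ∀ {y Y} → route ≡ y ∷ Y → Step R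
      visitRoute route≡ with route | route-path | route-unvisited | route-unique | route-covers | route≡
      ... | y ∷ Y | p | y∉R ∷ Y∉R | y∉Y ∷ uY | covers | refl = y , y∉R , record
        { prefix          = visit prefix y∉R (offs , anchor , older , split , Path-first-edge p , offs-exhausted)
        ; t∉R             = ∉-∷ (λ { refl → All.lookup y∉Y (∈-++⁺ʳ Y (here refl)) refl }) t∉R
        ; offs            = []
        ; anchor          = y
        ; older           = R
        ; split           = refl
        ; route           = Y
        ; route-path      = Path-tail p
        ; route-unvisited = All.zipWith (λ (x∉R , y≢x) → ∉-∷ (y≢x ∘ ≡-sym) x∉R) (Y∉R , Allₚ.++⁻ˡ Y y∉Y)
        ; route-unique    = uY
        ; route-covers    = covers′
        ; offs-cut        = []
        ; stranded        = λ u∉ ¬ut → let u≢y , u∉R = ∉-∷⁻ u∉ in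
                            reattach u≢y ¬ut (inj₁ (unstranded offs-exhausted anchor-reach u∉R))
        }
        where
          covers′ : ∀ {x} → t ~ x → x ∉ y ∷ R → x ∈ Y
          covers′ tx x∉ with covers tx (proj₂ (∉-∷⁻ x∉))
          ... | here refl = ⊥-elim (x∉ (here refl))
          ... | there x∈Y = x∈Y

      advance : Step R ⊎ Complete R
      advance with route in route≡
      ... | []    = inj₂ (finish route≡)
      ... | _ ∷ _ = inj₁ (visitRoute route≡)

    strandedNeighbour? : ∀ R p → (∃[ v ] (p ~ v × v ∉ R × ¬ Reach R v t)) ⊎
                                 (∀ {w} → p ~ w → w ∉ R → Reach R w t)
    strandedNeighbour? R p with Finₚ.any? (λ v → p ~? v ×-dec ¬? (v ∈? R) ×-dec ¬? (reach? R v t))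
    ... | yes found = inj₁ found
    ... | no ¬found = inj₂ reach
      where
        reach : ∀ {w} → p ~ w → w ∉ R → Reach R w t
        reach {w} p~w w∉R with reach? R w t
        ... | yes r = r
        ... | no ¬r = ⊥-elim (¬found (w , p~w , w∉R , ¬r))

    next : ∀ {R} → State R → Step R ⊎ Complete R
    next {R} I with firstActive R R
    ... | inj₁ all-exhausted = ⊥-elim (anchor-exhausted (All.lookup all-exhausted anchor∈R))
      where
        open State I
        anchor∈R = subst (anchor ∈_) (≡-sym split) (∈-++⁺ʳ offs (here refl))
        anchor-exhausted : ¬ Exhausted R anchor
        anchor-exhausted ex = let w , a~w , w∉R = anchor-active in w∉R (ex w a~w)
    ... | inj₂ (A , p , B , R≡ , A-exhausted , (w₀ , p~w₀ , w₀∉R)) with strandedNeighbour? R p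
    ...   | inj₁ (v , p~v , v∉R , ¬vt) = inj₁ (v , v∉R , visitStranded I v∉R ¬vt (A , p , B , R≡ , p~v , A-exhausted))
    ...   | inj₂ p-reach with compareSplits (State.offs I) A (trans (≡-sym (State.split I)) R≡)
    ...     | inj₁ p∈offs = ⊥-elim (All.lookup (State.offs-cut I) p∈offs p~w₀ w₀∉R (p-reach p~w₀ w₀∉R))
    ...     | inj₂ (inj₂ anchor∈A) =
      let w , a~w , w∉R = State.anchor-active I in ⊥-elim (w∉R (All.lookup A-exhausted anchor∈A w a~w))
    ...     | inj₂ (inj₁ (refl , refl)) = advance I A-exhausted p-reach

    run : ∀ fuel {R} → outside allVertices R < fuel → State R → ∃[ R′ ] Complete R′
    run (suc fuel) {R} (s≤s bound) I with next I
    ... | inj₁ (v , v∉R , I′) = run fuel (ℕₚ.<-≤-trans (outside-shrinks allVertices v∉R (∈-allFin v)) bound) I′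
    ... | inj₂ complete       = R , complete

    initialState : Connected G → (P : AnchoredPath t) → t ~ AnchoredPath.to P →
                   (∀ {x} → t ~ x → x ∈ AnchoredPath.vertices P) → State [ AnchoredPath.from P ]
    initialState connected (anchored h l L p uL tL th) tl covers with Path-view p | uL
    ... | Y , refl | h∉Y ∷ uY = record
      { prefix          = start h
      ; t∉R             = λ { (here refl) → ~-irrefl th }
      ; offs            = []
      ; anchor          = h
      ; older           = []
      ; split           = refl
      ; route           = Y
      ; route-path      = glue p (~-sym tl) (single t)
      ; route-unvisited = All.map (λ h≢x → λ { (here refl) → h≢x refl }) h∉Y
      ; route-unique    = Uniqueₚ.++⁺ uY ([] ∷ []) λ { (t∈Y , here refl) → tL (there t∈Y) }
      ; route-covers    = route-covers
      ; offs-cut        = []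
      ; stranded        = λ {u} u∉ ¬ut →
          reattach (u∉ ∘ here) ¬ut (inj₁ (mapWalk (λ _ ()) (connected u t)))
      }
      where
        route-covers : ∀ {x} → t ~ x → x ∉ [ h ] → x ∈ Y
        route-covers tx x∉ with covers tx
        ... | here refl = ⊥-elim (x∉ (here refl))
        ... | there x∈Y = x∈Y

    ¬cut⇒connected : ¬ CutVertex G t → ∀ x y → x ≢ t → y ≢ t → Reach [ t ] x y
    ¬cut⇒connected ¬cut x y x≢t y≢t with reach? [ t ] x y
    ... | yes p = p
    ... | no ¬p = ⊥-elim (¬cut (x , y , x≢t , y≢t , ¬p ∘ mapWalk λ { z≢t (here z≡t) → z≢t z≡t }))

    completeDFS : ClawFree G → Connected G → ¬ CutVertex G t → ∀ {u} → u ≢ t → ∃[ R ] Complete R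
    completeDFS clawFree connected ¬cut {u} u≢t
      with neighbourhoodPath t clawFree (¬cut⇒connected ¬cut) allVertices
    ... | inj₁ no-neighbour = ⊥-elim (u≢t (isolated (connected t u)))
      where
        isolated : ∀ {v} → Walk (λ _ → ⊤) t v → v ≡ t
        isolated (here _)     = refl
        isolated (step _ t~w _) = ⊥-elim (no-neighbour (∈-allFin _) t~w)
    ... | inj₂ (P , tl , covers) =
      run (suc (outside allVertices [ AnchoredPath.from P ])) ℕₚ.≤-refl
          (initialState connected P tl (covers (∈-allFin _)))

  -- From visit lists to orderings

  DFSPrefix-unique : ∀ {R} → DFSPrefix R → Unique R
  DFSPrefix-unique (start _)       = [] ∷ []
  DFSPrefix-unique (visit d v∉ _)  = Unique-∷ v∉ (DFSPrefix-unique d)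

  DFSPrefix-legal : ∀ (C : List V) {v R} → DFSPrefix (C ++ v ∷ R) → R ≢ [] → LegalNext R v
  DFSPrefix-legal []          (start _)         R≢[] = ⊥-elim (R≢[] refl)
  DFSPrefix-legal []          (visit _ _ legal) _    = legal
  DFSPrefix-legal (_ ∷ [])    (visit d _ _)     R≢[] = DFSPrefix-legal [] d R≢[]
  DFSPrefix-legal (_ ∷ c ∷ C) (visit d _ _)     R≢[] = DFSPrefix-legal (c ∷ C) d R≢[]

  reverse-split : ∀ (L D : List V) {v X} → reverse L ≡ D ++ v ∷ X → L ≡ reverse X ++ v ∷ reverse D
  reverse-split L D {v} {X} eq = begin
    L                           ≡⟨ ≡-sym (Listₚ.reverse-involutive L) ⟩
    reverse (reverse L)         ≡⟨ cong reverse eq ⟩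
    reverse (D ++ v ∷ X)        ≡⟨ Listₚ.reverse-++ D (v ∷ X) ⟩
    reverse (v ∷ X) ++ reverse D ≡⟨ cong (_++ reverse D) (Listₚ.unfold-reverse v X) ⟩
    (reverse X ++ [ v ]) ++ reverse D ≡⟨ Listₚ.++-assoc (reverse X) [ v ] (reverse D) ⟩
    reverse X ++ v ∷ reverse D  ∎
    where open ≡-Reasoning

  ForwardLegal : List V → Set
  ForwardLegal L = ∀ D v X → L ≡ D ++ v ∷ X → D ≢ [] →
    ∃[ P₁ ] ∃[ p ] ∃[ P₂ ] (D ≡ P₁ ++ p ∷ P₂ × p ~ v × All (Exhausted D) P₂)

  DFSPrefix-forward : ∀ {R} → DFSPrefix R → ForwardLegal (reverse R)
  DFSPrefix-forward {R} d D v X eq D≢[]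
    with DFSPrefix-legal (reverse X) (subst DFSPrefix (reverse-split R D eq) d) (D≢[] ∘ reverse≡[])
    where
      reverse≡[] : reverse D ≡ [] → D ≡ []
      reverse≡[] eq′ = trans (≡-sym (Listₚ.reverse-involutive D)) (cong reverse eq′)
  ... | A , p , B , eq′ , p~v , A-exhausted =
    reverse B , p , reverse A , reverse-split D A eq′ , p~v ,
    All.tabulate λ x∈ w x~w → Anyₚ.reverse⁻ (All.lookup A-exhausted (Anyₚ.reverse⁻ x∈) w x~w)

  at : V → List V → ℕ → V
  at d []       _       = d
  at d (x ∷ _)  zero    = x
  at d (_ ∷ xs) (suc k) = at d xs k

  module _ {d : V} where

    at-∈ : ∀ (L : List V) {k} → k < length L → at d L k ∈ L
    at-∈ (x ∷ L) {zero}  _         = here refl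
    at-∈ (x ∷ L) {suc k} (s≤s k<L) = there (at-∈ L k<L)

    at-∈ˡ : ∀ (D : List V) {Y k} → k < length D → at d (D ++ Y) k ∈ D
    at-∈ˡ (x ∷ D) {k = zero}  _         = here refl
    at-∈ˡ (x ∷ D) {k = suc k} (s≤s k<D) = there (at-∈ˡ D k<D)

    at-length : ∀ {L} (D : List V) {v X} → L ≡ D ++ v ∷ X → at d L (length D) ≡ v
    at-length []      refl = refl
    at-length (_ ∷ D) refl = at-length D refl

    at-∈ʳ : ∀ {L} (D : List V) {Y k} → L ≡ D ++ Y → length D ≤ k → k < length L → at d L k ∈ Y
    at-∈ʳ []      {Y} refl _         k<L       = at-∈ Y k<L
    at-∈ʳ (_ ∷ D) {k = suc k} refl (s≤s D≤k) (s≤s k<L) = at-∈ʳ D refl D≤k k<L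

    at-∈-middle : ∀ {L} (P₁ : List V) {p P₂ Y k} → L ≡ P₁ ++ p ∷ P₂ ++ Y →
                  length P₁ < k → k < length P₁ + suc (length P₂) → at d L k ∈ P₂
    at-∈-middle []       {P₂ = P₂} {k = suc k} refl _ (s≤s k<P₂) = at-∈ˡ P₂ k<P₂
    at-∈-middle (_ ∷ P₁) {k = suc k} refl (s≤s P₁<k) (s≤s k<) = at-∈-middle P₁ refl P₁<k k<

    at-split : ∀ (L : List V) {k} → k < length L → ∃[ D ] ∃[ v ] ∃[ X ] (L ≡ D ++ v ∷ X × length D ≡ k)
    at-split (x ∷ L) {zero}  _ = [] , x , L , refl , refl
    at-split (x ∷ L) {suc k} (s≤s k<L) with at-split L k<L
    ... | D , v , X , refl , refl = x ∷ D , v , X , refl , refl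

    at-injective : ∀ (L : List V) {k₁ k₂} → Unique L → k₁ < length L → k₂ < length L →
                   at d L k₁ ≡ at d L k₂ → k₁ ≡ k₂
    at-injective (x ∷ L) {zero}   {zero}   _        _          _          _  = refl
    at-injective (x ∷ L) {zero}   {suc k₂} (x∉ ∷ _) _          (s≤s k₂<L) eq =
      ⊥-elim (All.lookup x∉ (at-∈ L k₂<L) eq)
    at-injective (x ∷ L) {suc k₁} {zero}   (x∉ ∷ _) (s≤s k₁<L) _          eq =
      ⊥-elim (All.lookup x∉ (at-∈ L k₁<L) (≡-sym eq))
    at-injective (x ∷ L) {suc k₁} {suc k₂} (_ ∷ uL) (s≤s k₁<L) (s≤s k₂<L) eq =
      cong suc (at-injective L uL k₁<L k₂<L eq)

    at-index : ∀ {L : List V} {x} → x ∈ L → ∃[ k ] (k < length L × at d L k ≡ x)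
    at-index (here refl) = zero , s≤s z≤n , refl
    at-index (there x∈)  = let k , k<L , eq = at-index x∈ in suc k , s≤s k<L , eq

    forward-parent : ∀ (L : List V) → Unique L → ForwardLegal L → ∀ {i} → 0 < i → i < length L →
      ∃[ j ] (j < i × at d L j ~ at d L i ×
              ∀ {j′ k} → j < j′ → j′ < i → i ≤ k → k < length L → ¬ at d L j′ ~ at d L k)
    forward-parent L uL legal 0<i i<L with at-split L i<L
    ... | D , v , X , L≡ , refl with legal D v X L≡ (λ { refl → ℕₚ.<-irrefl refl 0<i })
    ... | P₁ , p , P₂ , refl , p~v , P₂-exhausted =
      length P₁ , P₁<before , subst₂ _~_ (≡-sym (at-length P₁ L≡′)) (≡-sym (at-length before L≡)) p~v , blocked
      where
        before : List V
        before = P₁ ++ p ∷ P₂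
        L≡′ : L ≡ P₁ ++ p ∷ P₂ ++ v ∷ X
        L≡′ = trans L≡ (Listₚ.++-assoc P₁ (p ∷ P₂) (v ∷ X))
        |before| : length before ≡ length P₁ + suc (length P₂)
        |before| = Listₚ.length-++ P₁
        P₁<before : length P₁ < length before
        P₁<before = subst (length P₁ <_) (≡-sym |before|) (ℕₚ.m<m+n (length P₁) (s≤s z≤n))
        blocked : ∀ {j′ k} → length P₁ < j′ → j′ < length before → length before ≤ k → k < length L →
                  ¬ at d L j′ ~ at d L k
        blocked P₁<j′ j′<before before≤k k<L e = Unique-++⇒disjoint before (subst Unique L≡ uL)
          (All.lookup P₂-exhausted (at-∈-middle P₁ L≡′ P₁<j′ (subst (_ <_) |before| j′<before)) _ e)
          (at-∈ʳ before L≡ before≤k k<L)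

  enumerationOrdering : ∀ (D : List V) t → let L = D ++ [ t ] in
                        Unique L → (∀ x → x ∈ L) → ForwardLegal L → ∃[ σ ] (IsDFSOrdering G σ × IsLast σ t)
  enumerationOrdering D t uL covers legal = σ , ((injective , surjective) , parent) , last
    where
      d = t
      L = D ++ [ t ]
      σ : Fin n → V
      σ i = at d L (toℕ i)
      |L| : length L ≡ n
      |L| = ℕₚ.≤-antisym (Finₚ.injective⇒≤ at-inj) (Finₚ.injective⇒≤ index-inj)
        where
          at-inj : ∀ {i j : Fin (length L)} → at d L (toℕ i) ≡ at d L (toℕ j) → i ≡ j
          at-inj {i} {j} eq = Finₚ.toℕ-injective (at-injective L uL (Finₚ.toℕ<n i) (Finₚ.toℕ<n j) eq)
          index : V → Fin (length L)
          index x = F.fromℕ< (proj₁ (proj₂ (at-index (covers x))))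
          at-index′ : ∀ x → at d L (toℕ (index x)) ≡ x
          at-index′ x = trans (cong (at d L) (Finₚ.toℕ-fromℕ< _)) (proj₂ (proj₂ (at-index (covers x))))
          index-inj : ∀ {x y} → index x ≡ index y → x ≡ y
          index-inj {x} {y} eq = trans (≡-sym (at-index′ x)) (trans (cong (at d L ∘ toℕ) eq) (at-index′ y))
      <|L| : ∀ (i : Fin n) → toℕ i < length L
      <|L| i = subst (toℕ i <_) (≡-sym |L|) (Finₚ.toℕ<n i)
      injective : ∀ {i j} → σ i ≡ σ j → i ≡ j
      injective {i} {j} eq = Finₚ.toℕ-injective (at-injective L uL (<|L| i) (<|L| j) eq)
      surjective : ∀ x → ∃[ i ] (∀ {j} → j ≡ i → σ j ≡ x)
      surjective x with at-index (covers x)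
      ... | k , k<L , eq = F.fromℕ< (subst (k <_) |L| k<L) , λ { refl → trans (cong (at d L) (Finₚ.toℕ-fromℕ< _)) eq }
      Blocked : Fin n → Fin n → Set
      Blocked i j = ¬ HasUnvisitedNbr G σ i j
      parent : ∀ i → (∀ j → toℕ j < toℕ i → Blocked i j) ⊎
               (∃[ j ] (toℕ j < toℕ i × σ j ~ σ i ×
                        (∀ j′ → toℕ j < toℕ j′ → toℕ j′ < toℕ i → Blocked i j′)))
      parent F.zero    = inj₁ λ _ ()
      parent i@(F.suc _) with forward-parent L uL legal (s≤s z≤n) (<|L| i)
      ... | j , j<i , σj~σi , blocked =
        inj₂ (F.fromℕ< j<n , subst (_< toℕ i) (≡-sym toℕ-j) j<i ,
              subst (λ k → at d L k ~ σ i) (≡-sym toℕ-j) σj~σi ,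
              λ j′ j<j′ j′<i (k , i≤k , e) → blocked (subst (_< toℕ j′) toℕ-j j<j′) j′<i i≤k (<|L| k) e)
        where
          j<n = ℕₚ.<-trans j<i (Finₚ.toℕ<n i)
          toℕ-j = Finₚ.toℕ-fromℕ< j<n
      |L|′ : suc (length D) ≡ n
      |L|′ = trans (≡-sym (trans (Listₚ.length-++ D) (ℕₚ.+-comm (length D) 1))) |L|
      |D|<n : length D < n
      |D|<n = subst (length D <_) |L|′ ℕₚ.≤-refl
      last : IsLast σ t
      last = F.fromℕ< |D|<n ,
             trans (cong (at d L) (Finₚ.toℕ-fromℕ< |D|<n)) (at-length D refl) ,
             λ k → subst (toℕ k ≤_) (≡-sym (Finₚ.toℕ-fromℕ< |D|<n))
                     (ℕₚ.≤-pred (subst (toℕ k <_) (≡-sym |L|′) (Finₚ.toℕ<n k)))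

  Unique-reverse : ∀ {L : List V} → Unique L → Unique (reverse L)
  Unique-reverse {[]}    _          = []
  Unique-reverse {x ∷ L} (x∉L ∷ uL) = subst Unique (≡-sym (Listₚ.unfold-reverse x L))
    (Uniqueₚ.++⁺ (Unique-reverse uL) ([] ∷ []) λ { (x∈ , here refl) → All.lookup x∉L (Anyₚ.reverse⁻ x∈) refl })

  complete⇒ordering : ∀ {t R} → Complete t R → ∃[ σ ] (IsDFSOrdering G σ × IsLast σ t)
  complete⇒ordering {t} {R} (d , covers) =
    enumerationOrdering (reverse R) t
      (subst Unique L≡ (Unique-reverse (DFSPrefix-unique d)))
      (λ x → subst (x ∈_) L≡ (Anyₚ.reverse⁺ (covers x)))
      (subst ForwardLegal L≡ (DFSPrefix-forward d))
    where
      L≡ : reverse (t ∷ R) ≡ reverse R ++ [ t ]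
      L≡ = Listₚ.unfold-reverse t R

  ¬cut⇒lastOfDFS : ClawFree G → Connected G → ∀ {t} → ¬ CutVertex G t → ∃[ σ ] (IsDFSOrdering G σ × IsLast σ t)
  ¬cut⇒lastOfDFS clawFree connected {t} ¬cut with Finₚ.any? (λ u → ¬? (u ≟ t))
  ... | yes (u , u≢t) = complete⇒ordering (proj₂ (completeDFS t clawFree connected ¬cut u≢t))
  ... | no ¬other     = complete⇒ordering {R = []} (start t , only-t)
    where
      only-t : ∀ u → u ∈ [ t ]
      only-t u with u ≟ t
      ... | yes u≡t = here u≡t
      ... | no u≢t  = ⊥-elim (¬other (u , u≢t))

  -- The last vertex of a DFS ordering is not a cut vertex

  crossing : ∀ {A x y} (f : V → ℕ) {m} → Walk A x y → f x < m → m ≤ f y →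
             ∃[ z ] ∃[ w ] (f z < m × m ≤ f w × z ~ w)
  crossing f (here _) fx<m m≤fy = ⊥-elim (ℕₚ.<⇒≱ fx<m m≤fy)
  crossing f {m} (step {u = x} {w = w} _ e p) fx<m m≤fy with m ℕₚ.≤? f w
  ... | yes m≤fw = x , w , fx<m , m≤fw , e
  ... | no m≰fw  = crossing f p (ℕₚ.≰⇒> m≰fw) m≤fy

  module _ {σ : Fin n → V} (connected : Connected G) (dfs : IsDFSOrdering G σ) where

    private
      position : V → Fin n
      position x = proj₁ (proj₂ (proj₁ dfs) x)

      σ-position : ∀ x → σ (position x) ≡ x
      σ-position x = proj₂ (proj₂ (proj₁ dfs) x) refl

      position-σ : ∀ i → position (σ i) ≡ i
      position-σ i = proj₁ (proj₁ dfs) (σ-position (σ i))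

    parent : ∀ i → 0 < toℕ i → ∃[ j ] (toℕ j < toℕ i × σ j ~ σ i)
    parent i 0<i with proj₂ dfs i
    ... | inj₂ (j , j<i , e , _) = j , j<i , e
    ... | inj₁ no-active
      with crossing (toℕ ∘ position) (connected (σ root) (σ i))
                    (at-root 0<i) (ℕₚ.≤-reflexive (cong toℕ (≡-sym (position-σ i))))
      where
        root : Fin n
        root = F.fromℕ< (ℕₚ.<-trans 0<i (Finₚ.toℕ<n i))
        at-root : 0 < toℕ i → toℕ (position (σ root)) < toℕ i
        at-root = subst (_< toℕ i) (≡-sym (trans (cong toℕ (position-σ root)) (Finₚ.toℕ-fromℕ< _)))
    ... | z , w , z<i , i≤w , z~w =
      ⊥-elim (no-active (position z) z<i (position w , i≤w , subst₂ _~_ (≡-sym (σ-position z)) (≡-sym (σ-position w)) z~w))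

    module _ {t} (last : IsLast σ t) where

      walkToRoot : ∀ fuel i → toℕ i < fuel → σ i ≢ t → ∀ r → toℕ r ≡ 0 → Walk (_≢ t) (σ i) (σ r)
      walkToRoot (suc fuel) i (s≤s i≤fuel) σi≢t r r≡0 with toℕ i ℕₚ.≟ 0
      ... | yes i≡0 = subst (Walk _ (σ i) ∘ σ) (Finₚ.toℕ-injective (trans i≡0 (≡-sym r≡0))) (here σi≢t)
      ... | no i≢0 with parent i (ℕₚ.n≢0⇒n>0 i≢0)
      ...   | j , j<i , σj~σi = step σi≢t (~-sym σj~σi) (walkToRoot fuel j (ℕₚ.<-≤-trans j<i i≤fuel) σj≢t r r≡0)
        where
          σj≢t : σ j ≢ t
          σj≢t σj≡t = let ℓ , σℓ≡t , ℓ-last = last in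
            ℕₚ.<⇒≱ j<i (subst (λ k → toℕ i ≤ toℕ k)
                               (proj₁ (proj₁ dfs) (trans σℓ≡t (≡-sym σj≡t))) (ℓ-last i))

      lastOfDFS⇒¬cut : ¬ CutVertex G t
      lastOfDFS⇒¬cut (u , v , u≢t , v≢t , ¬walk) = ¬walk (toRoot u u≢t ++ʷ reverseWalk (toRoot v v≢t))
        where
          root : Fin n
          root = F.fromℕ< (ℕₚ.≤-<-trans z≤n (Finₚ.toℕ<n u))
          toRoot : ∀ x → x ≢ t → Walk (_≢ t) x (σ root)
          toRoot x x≢t = subst (λ y → Walk (_≢ t) y (σ root)) (σ-position x)
            (walkToRoot _ (position x) ℕₚ.≤-refl (subst (_≢ t) (≡-sym (σ-position x)) x≢t)
                        root (Finₚ.toℕ-fromℕ< _))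

theorem19 : ∀ {n : ℕ} (G : Graph n) → Connected G → ClawFree G → NetFree G → (t : Fin n) →
    ((∃[ σ ] (IsDFSOrdering G σ × IsLast σ t)) → ¬ CutVertex G t) ×
    (¬ CutVertex G t → ∃[ σ ] (IsDFSOrdering G σ × IsLast σ t))
theorem19 G connected clawFree _ t =
  (λ (σ , dfs , last) → lastOfDFS⇒¬cut G connected dfs last) ,
  ¬cut⇒lastOfDFS G clawFree connected
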